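{- For every integer $k\ge 1$, \[\alpha(K(2k,k))=\psi(K(2k,k))=\left\lfloor \frac12+\sqrt{\frac14+\binom{2k}{k}}\right\rfloor.\]
   Context: The Kneser graph $K(2k,k)$ has as vertices all $k$-element subsets of $[2k]=\{1,\dots,2k\}$, two vertices being adjacent iff the subsets are disjoint. An $l$-coloring of a graph $G$ is a surjective map $V(G)\to[l]$; it is proper if adjacent vertices get different colors and complete if for every two distinct colors $i,j$ there is an edge with endpoints colored $i$ and $j$. The achromatic number $\alpha(G)$ is the largest $l$ admitting a proper complete $l$-coloring; the pseudoachromatic number $\psi(G)$ is the largest $l$ admitting a complete $l$-coloring. -}

module Defs where

open import Data.Nat using (ℕ; suc; _+_; _*_; _≤_; _<_)
open import Data.Nat.Combinatorics using (_C_)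
open import Data.Fin using (Fin)
open import Data.Fin.Subset using (Subset; _∩_; ∣_∣; Empty)
open import Data.Product using (Σ; ∃; _×_; _,_)
open import Relation.Binary.PropositionalEquality using (_≡_; _≢_)

record Graph : Set₁ where
  field
    V   : Set
    Adj : V → V → Set
open Graph public

KneserVertex : ℕ → Set
KneserVertex k = Σ (Subset (2 * k)) (λ p → ∣ p ∣ ≡ k)

Kneser : ℕ → Graph
Kneser k = record
  { V   = KneserVertex k
  ; Adj = λ { (p , _) (q , _) → Empty (p ∩ q) }
  }

Surjective : {A B : Set} → (A → B) → Set
Surjective {A} f = ∀ b → ∃ λ (a : A) → f a ≡ b

Proper : (G : Graph) {l : ℕ} → (V G → Fin l) → Set
Proper G c = ∀ u v → Adj G u v → c u ≢ c v

Complete : (G : Graph) {l : ℕ} → (V G → Fin l) → Set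
Complete G {l} c = (i j : Fin l) → i ≢ j →
  ∃ λ u → ∃ λ v → Adj G u v × c u ≡ i × c v ≡ j

HasProperComplete : Graph → ℕ → Set
HasProperComplete G l =
  ∃ λ (c : V G → Fin l) → Surjective c × Proper G c × Complete G c

HasComplete : Graph → ℕ → Set
HasComplete G l =
  ∃ λ (c : V G → Fin l) → Surjective c × Complete G c

IsLargest : (ℕ → Set) → ℕ → Set
IsLargest P n = P n × (∀ m → P m → m ≤ n)

AchromaticNumber : Graph → ℕ → Set
AchromaticNumber G = IsLargest (HasProperComplete G)

PseudoachromaticNumber : Graph → ℕ → Set
PseudoachromaticNumber G = IsLargest (HasComplete G)

IsFloorSqrt : ℕ → ℕ → Set
IsFloorSqrt n s = s * s ≤ n × n < suc s * suc s

module Submission where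

-- Two k-subsets of [2k] are disjoint exactly when each is the complement
-- of the other, so K(2k,k) is a perfect matching with M = C(2k,k)/2 edges:
-- every vertex has exactly one neighbour.  For a graph of this shape both
-- numbers are the largest l with l(l-1) ≤ 2M:
--   * upper bound: in a complete l-colouring pick, for every ordered pair
--     of distinct colours (i,j), an edge coloured i—j; its i-coloured end
--     determines the edge and hence (i,j), so l(l-1) ≤ #vertices = 2M;
--   * lower bound: if l(l-1)/2 ≤ M, give each of the l(l-1)/2 unordered
--     colour pairs its own edge (remaining edges reuse one pair) and colour
--     the two ends of each edge by the two colours of its pair; the result
--     is proper and complete.

open import Defs
open import Data.Nat using (ℕ; zero; suc; _+_; _*_; _∸_; _≤_; _<_; z≤n; s≤s; s≤s⁻¹; _/_; _<?_)
open import Data.Nat.Properties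
open import Data.Nat.Combinatorics using (_C_; nCk+nC[k+1]≡[n+1]C[k+1]; nCk≡nC[n∸k])
open import Data.Nat.DivMod using (m/n*n≤m; m*n/n≡m; /-monoˡ-≤)
open import Data.Nat.Tactic.RingSolver using (solve-∀)
open import Data.Bool using (Bool; true; false; not)
open import Data.Bool.Properties using (not-involutive)
open import Data.Vec using ([]; _∷_; here)
open import Data.Vec.Properties using (map-∘; map-cong; map-id)
open import Data.Fin using (Fin; zero; suc; toℕ; fromℕ<; inject≤; punchIn; splitAt; _↑ˡ_; _↑ʳ_; remQuot; combine)
open import Data.Fin.Properties
  using (toℕ<n; toℕ-inject≤; fromℕ<-toℕ; fromℕ<-cong; splitAt-↑ˡ; splitAt-↑ʳ; punchInᵢ≢i; punchIn-injective;
         combine-remQuot; combine-injective; injective⇒≤; +↔⊎)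
open import Data.Fin.Subset using (Subset; ∁; _∩_; ∣_∣; Empty; ⊥; inside; outside; _∈_)
open import Data.Fin.Subset.Properties using (∣∁p∣≡n∸∣p∣; ∣⊥∣≡0; drop-∷-Empty; ∉⊥; ∩-inverseˡ; ∩-inverseʳ)
open import Data.Sum using (_⊎_; inj₁; inj₂)
open import Data.Sum.Function.Propositional using (_⊎-↔_)
open import Data.Product using (Σ; ∃; _×_; _,_; proj₁; proj₂; uncurry)
import Data.Product as Product
open import Data.Empty using (⊥-elim)
open import Function using (_∘_; _↔_; Inverse; mk↔ₛ′)
open import Function.Properties.Inverse using (↔-sym; ↔-trans)
open import Relation.Nullary using (yes; no)
open import Relation.Binary.PropositionalEquality

private
  variable
    a b n m : ℕ

SizedSubset : ℕ → ℕ → Set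
SizedSubset n m = Σ (Subset n) λ p → ∣ p ∣ ≡ m

sized-≡ : {u v : SizedSubset n m} → proj₁ u ≡ proj₁ v → u ≡ v
sized-≡ {u = p , e} {.p , e′} refl = cong (p ,_) (≡-irrelevant e e′)

-- Binomial coefficients by Pascal's rule; this is the recursion along which
-- sized subsets are enumerated.
pascal : ℕ → ℕ → ℕ
pascal n       zero    = 1
pascal zero    (suc m) = 0
pascal (suc n) (suc m) = pascal n m + pascal n (suc m)

pascal≡C : ∀ n m → pascal n m ≡ n C m
pascal≡C n       zero    = refl
pascal≡C zero    (suc m) = refl
pascal≡C (suc n) (suc m) =
  trans (cong₂ _+_ (pascal≡C n m) (pascal≡C n (suc m))) (nCk+nC[k+1]≡[n+1]C[k+1] n m)

pascal-positive : m ≤ n → 0 < pascal n m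
pascal-positive {zero}  _         = s≤s z≤n
pascal-positive {suc m} (s≤s m≤n) = ≤-trans (pascal-positive m≤n) (m≤m+n _ _)

size-zero⇒⊥ : (p : Subset n) → ∣ p ∣ ≡ 0 → p ≡ ⊥
size-zero⇒⊥ []            _ = refl
size-zero⇒⊥ (outside ∷ p) e = cong (outside ∷_) (size-zero⇒⊥ p e)

emptySubset↔ : SizedSubset n 0 ↔ Fin 1
emptySubset↔ {n} = mk↔ₛ′ (λ _ → zero) (λ _ → ⊥ , ∣⊥∣≡0 n) (λ { zero → refl })
  (λ (p , e) → sized-≡ (sym (size-zero⇒⊥ p e)))

noSubset↔ : SizedSubset 0 (suc m) ↔ Fin 0
noSubset↔ = mk↔ₛ′ (λ { ([] , ()) }) (λ ()) (λ ()) (λ { ([] , ()) })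

splitFirst↔ : SizedSubset (suc n) (suc m) ↔ (SizedSubset n m ⊎ SizedSubset n (suc m))
splitFirst↔ = mk↔ₛ′ to from (λ { (inj₁ _) → cong inj₁ (sized-≡ refl) ; (inj₂ _) → refl })
  (λ { (inside ∷ _ , _) → sized-≡ refl ; (outside ∷ _ , _) → refl })
  where
  to : SizedSubset (suc n) (suc m) → SizedSubset n m ⊎ SizedSubset n (suc m)
  to (inside  ∷ p , e) = inj₁ (p , suc-injective e)
  to (outside ∷ p , e) = inj₂ (p , e)
  from : SizedSubset n m ⊎ SizedSubset n (suc m) → SizedSubset (suc n) (suc m)
  from (inj₁ (p , e)) = inside ∷ p , cong suc e
  from (inj₂ (p , e)) = outside ∷ p , e

sizedSubset↔ : ∀ n m → SizedSubset n m ↔ Fin (pascal n m)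
sizedSubset↔ n       zero    = emptySubset↔
sizedSubset↔ zero    (suc m) = noSubset↔
sizedSubset↔ (suc n) (suc m) =
  ↔-trans splitFirst↔ (↔-trans (sizedSubset↔ n m ⊎-↔ sizedSubset↔ n (suc m)) (↔-sym +↔⊎))

∁-involutive : (p : Subset n) → ∁ (∁ p) ≡ p
∁-involutive p = trans (sym (map-∘ not not p)) (trans (map-cong not-involutive p) (map-id p))

p∩∁p-empty : (p : Subset n) → Empty (p ∩ ∁ p)
p∩∁p-empty p (x , x∈) = ∉⊥ (subst (x ∈_) (∩-inverseʳ p) x∈)

∁p∩p-empty : (p : Subset n) → Empty (∁ p ∩ p)
∁p∩p-empty p (x , x∈) = ∉⊥ (subst (x ∈_) (∩-inverseˡ p) x∈)

size-∁ : (p : Subset n) → ∣ p ∣ ≡ a → a + b ≡ n → ∣ ∁ p ∣ ≡ b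
size-∁ {n} {a} {b} p e split = begin
  ∣ ∁ p ∣   ≡⟨ ∣∁p∣≡n∸∣p∣ p ⟩
  n ∸ ∣ p ∣  ≡⟨ cong₂ _∸_ (sym split) e ⟩
  a + b ∸ a ≡⟨ m+n∸m≡n a b ⟩
  b         ∎
  where open ≡-Reasoning

disjoint-size : (p q : Subset n) → Empty (p ∩ q) → ∣ p ∣ + ∣ q ∣ ≤ n
disjoint-size []            []            _ = z≤n
disjoint-size (inside  ∷ p) (inside  ∷ q) h = ⊥-elim (h (zero , here))
disjoint-size (inside  ∷ p) (outside ∷ q) h = s≤s (disjoint-size p q (drop-∷-Empty h))
disjoint-size {suc n} (outside ∷ p) (inside  ∷ q) h =
  subst (_≤ suc n) (sym (+-suc ∣ p ∣ ∣ q ∣)) (s≤s (disjoint-size p q (drop-∷-Empty h)))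
disjoint-size (outside ∷ p) (outside ∷ q) h = m≤n⇒m≤1+n (disjoint-size p q (drop-∷-Empty h))

disjoint-full⇒∁ : (p q : Subset n) → Empty (p ∩ q) → ∣ p ∣ + ∣ q ∣ ≡ n → q ≡ ∁ p
disjoint-full⇒∁ []            []            _ _ = refl
disjoint-full⇒∁ (inside  ∷ p) (inside  ∷ q) h _ = ⊥-elim (h (zero , here))
disjoint-full⇒∁ (inside  ∷ p) (outside ∷ q) h e =
  cong (outside ∷_) (disjoint-full⇒∁ p q (drop-∷-Empty h) (suc-injective e))
disjoint-full⇒∁ (outside ∷ p) (inside  ∷ q) h e =
  cong (inside ∷_) (disjoint-full⇒∁ p q (drop-∷-Empty h) (suc-injective (trans (sym (+-suc ∣ p ∣ ∣ q ∣)) e)))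
disjoint-full⇒∁ {suc n} (outside ∷ p) (outside ∷ q) h e =
  ⊥-elim (<⇒≱ ≤-refl (subst (_≤ n) e (disjoint-size p q (drop-∷-Empty h))))

complete⇒surjective : (G : Graph) (c : V G → Fin (suc (suc a))) → Complete G c → Surjective c
complete⇒surjective G c complete zero    with complete zero (suc zero) (λ ())
... | u , _ , _ , cu , _ = u , cu
complete⇒surjective G c complete (suc i) with complete (suc i) zero (λ ())
... | u , _ , _ , cu , _ = u , cu

AdjacencyFunctional : Graph → Set
AdjacencyFunctional G = ∀ {u v w} → Adj G u v → Adj G u w → v ≡ w

ColouredEdge : (G : Graph) → (V G → Fin n) → Fin n → Fin n → Set
ColouredEdge G c i j = ∃ λ u → ∃ λ v → Adj G u v × c u ≡ i × c v ≡ j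

colouredEdge-source-injective : (G : Graph) → AdjacencyFunctional G → {c : V G → Fin (suc n)} →
  ∀ {i₁ i₂ j₁ j₂} (e₁ : ColouredEdge G c i₁ (punchIn i₁ j₁)) (e₂ : ColouredEdge G c i₂ (punchIn i₂ j₂)) →
  proj₁ e₁ ≡ proj₁ e₂ → (i₁ , j₁) ≡ (i₂ , j₂)
colouredEdge-source-injective G functional {c} (u , v₁ , adj₁ , refl , cv₁) (.u , v₂ , adj₂ , refl , cv₂) refl
  with refl ← functional adj₁ adj₂ = cong (c u ,_) (punchIn-injective (c u) _ _ (trans (sym cv₁) cv₂))

-- Upper bound: if every vertex has at most one neighbour and the vertices
-- inject into Fin N, a complete (l+1)-colouring has (l+1)l ≤ N, since the
-- ordered pairs of distinct colours inject into the vertices.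
complete⇒pairs≤vertices : (G : Graph) {N l : ℕ} (index : V G → Fin N) →
  (∀ {u v} → index u ≡ index v → u ≡ v) → AdjacencyFunctional G →
  (c : V G → Fin (suc l)) → Complete G c → suc l * l ≤ N
complete⇒pairs≤vertices G {N} {l} index index-injective functional c complete =
  injective⇒≤ {f = code ∘ remQuot l} (λ eq → remQuot-injective (code-injective eq))
  where
  edgeFor : (i : Fin (suc l)) (j : Fin l) → ColouredEdge G c i (punchIn i j)
  edgeFor i j = complete i (punchIn i j) (punchInᵢ≢i i j ∘ sym)
  code : Fin (suc l) × Fin l → Fin N
  code (i , j) = index (proj₁ (edgeFor i j))
  code-injective : ∀ {x y} → code x ≡ code y → x ≡ y
  code-injective {i₁ , j₁} {i₂ , j₂} eq =
    colouredEdge-source-injective G functional (edgeFor i₁ j₁) (edgeFor i₂ j₂) (index-injective eq)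
  remQuot-injective : ∀ {x y : Fin (suc l * l)} → remQuot l x ≡ remQuot l y → x ≡ y
  remQuot-injective {x} {y} eq =
    trans (sym (combine-remQuot {suc l} l x)) (trans (cong (uncurry combine) eq) (combine-remQuot l y))

sideIndex : Bool → Fin 2
sideIndex true  = zero
sideIndex false = suc zero

endIndex : Fin n × Bool → Fin (2 * n)
endIndex (y , b) = combine (sideIndex b) y

endIndex-injective : ∀ {x x′ : Fin n × Bool} → endIndex x ≡ endIndex x′ → x ≡ x′
endIndex-injective {x = y , b} {y′ , b′} eq with combine-injective (sideIndex b) y (sideIndex b′) y′ eq
... | side≡ , refl = cong (y ,_) (sideIndex-injective b b′ side≡)
  where
  sideIndex-injective : ∀ b b′ → sideIndex b ≡ sideIndex b′ → b ≡ b′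
  sideIndex-injective true  true  _ = refl
  sideIndex-injective false false _ = refl

partner : Fin n × Bool → Fin n × Bool
partner (y , b) = y , not b

record PerfectMatching (G : Graph) (M : ℕ) : Set where
  field
    endpoint           : Fin M × Bool → V G
    locate             : V G → Fin M × Bool
    endpoint-locate    : ∀ v → endpoint (locate v) ≡ v
    locate-endpoint    : ∀ x → locate (endpoint x) ≡ x
    endpoints-adjacent : ∀ x → Adj G (endpoint x) (endpoint (partner x))
    adjacent⇒partner   : ∀ {u v} → Adj G u v → locate v ≡ partner (locate u)

  locate-injective : ∀ {u v} → locate u ≡ locate v → u ≡ v
  locate-injective {u} {v} eq = trans (sym (endpoint-locate u)) (trans (cong endpoint eq) (endpoint-locate v))

  adjacencyFunctional : AdjacencyFunctional G
  adjacencyFunctional adj₁ adj₂ = locate-injective (trans (adjacent⇒partner adj₁) (sym (adjacent⇒partner adj₂)))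

  vertexIndex : V G → Fin (2 * M)
  vertexIndex = endIndex ∘ locate

  vertexIndex-injective : ∀ {u v} → vertexIndex u ≡ vertexIndex v → u ≡ v
  vertexIndex-injective = locate-injective ∘ endIndex-injective

Covers : Fin n × Fin n → Fin n → Fin n → Set
Covers d i j = d ≡ (i , j) ⊎ d ≡ (j , i)

record PairSchedule (M l : ℕ) : Set where
  field
    pairAt   : Fin M → Fin l × Fin l
    distinct : ∀ y → proj₁ (pairAt y) ≢ proj₂ (pairAt y)
    covers   : ∀ i j → i ≢ j → ∃ λ y → Covers (pairAt y) i j

module _ {G : Graph} {M : ℕ} (matching : PerfectMatching G M) where
  open PerfectMatching matching

  matching⇒colourBound : ∀ {l} (c : V G → Fin (suc l)) → Complete G c → suc l * l ≤ 2 * M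
  matching⇒colourBound = complete⇒pairs≤vertices G vertexIndex vertexIndex-injective adjacencyFunctional

  module _ {l : ℕ} (schedule : PairSchedule M l) where
    open PairSchedule schedule

    endColour : Fin M × Bool → Fin l
    endColour (y , true)  = proj₁ (pairAt y)
    endColour (y , false) = proj₂ (pairAt y)

    endColour-partner : ∀ x → endColour x ≢ endColour (partner x)
    endColour-partner (y , true)  = distinct y
    endColour-partner (y , false) = distinct y ∘ sym

    scheduledColouring : V G → Fin l
    scheduledColouring = endColour ∘ locate

    endpoint-colour : ∀ x → scheduledColouring (endpoint x) ≡ endColour x
    endpoint-colour x = cong endColour (locate-endpoint x)

    scheduled-proper : Proper G scheduledColouring
    scheduled-proper u v adj same =
      endColour-partner (locate u) (trans same (cong endColour (adjacent⇒partner adj)))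

    scheduled-complete : Complete G scheduledColouring
    scheduled-complete i j i≢j with covers i j i≢j
    ... | y , inj₁ eq = endpoint (y , true) , endpoint (y , false) , endpoints-adjacent (y , true)
                      , trans (endpoint-colour _) (cong proj₁ eq) , trans (endpoint-colour _) (cong proj₂ eq)
    ... | y , inj₂ eq = endpoint (y , false) , endpoint (y , true) , endpoints-adjacent (y , false)
                      , trans (endpoint-colour _) (cong proj₂ eq) , trans (endpoint-colour _) (cong proj₁ eq)

  matching⇒properComplete : PairSchedule M (suc (suc a)) → HasProperComplete G (suc (suc a))
  matching⇒properComplete schedule =
    scheduledColouring schedule ,
    complete⇒surjective G _ (scheduled-complete schedule) ,
    scheduled-proper schedule ,
    scheduled-complete schedule

-- triangle l = l(l-1)/2, the number of unordered pairs from l colours.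
triangle : ℕ → ℕ
triangle zero    = 0
triangle (suc l) = l + triangle l

triangle-double : ∀ a → 2 * triangle (suc a) ≡ suc a * a
triangle-double zero    = refl
triangle-double (suc a) = begin
  2 * (suc a + triangle (suc a))      ≡⟨ *-distribˡ-+ 2 (suc a) (triangle (suc a)) ⟩
  2 * suc a + 2 * triangle (suc a)    ≡⟨ cong (2 * suc a +_) (triangle-double a) ⟩
  2 * suc a + suc a * a               ≡⟨ step a ⟩
  suc (suc a) * suc a                 ∎
  where
  open ≡-Reasoning
  step : ∀ a → 2 * suc a + suc a * a ≡ suc (suc a) * suc a
  step = solve-∀

pairsFrom : ∀ l → Fin l ⊎ Fin (triangle l) → Fin (suc l) × Fin (suc l)
allPairs : ∀ l → Fin (triangle l) → Fin l × Fin l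
allPairs zero    ()
allPairs (suc l) x = pairsFrom l (splitAt l x)
pairsFrom l (inj₁ j) = zero , suc j
pairsFrom l (inj₂ x) = Product.map suc suc (allPairs l x)

allPairs-distinct : ∀ l x → proj₁ (allPairs l x) ≢ proj₂ (allPairs l x)
pairsFrom-distinct : ∀ l z → proj₁ (pairsFrom l z) ≢ proj₂ (pairsFrom l z)
allPairs-distinct (suc l) x = pairsFrom-distinct l (splitAt l x)
pairsFrom-distinct l (inj₁ j) ()
pairsFrom-distinct l (inj₂ x) eq = allPairs-distinct l x (Data.Fin.Properties.suc-injective eq)

allPairs-covers : ∀ l (i j : Fin l) → i ≢ j → ∃ λ x → Covers (allPairs l x) i j
allPairs-covers (suc l) zero    zero    i≢j = ⊥-elim (i≢j refl)
allPairs-covers (suc l) zero    (suc j) _   = j ↑ˡ triangle l , inj₁ (cong (pairsFrom l) (splitAt-↑ˡ l j (triangle l)))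
allPairs-covers (suc l) (suc i) zero    _   = i ↑ˡ triangle l , inj₂ (cong (pairsFrom l) (splitAt-↑ˡ l i (triangle l)))
allPairs-covers (suc l) (suc i) (suc j) i≢j with allPairs-covers l i j (i≢j ∘ cong suc)
... | x , cover = l ↑ʳ x , shift cover
  where
  shifted : allPairs (suc l) (l ↑ʳ x) ≡ Product.map suc suc (allPairs l x)
  shifted = cong (pairsFrom l) (splitAt-↑ʳ l (triangle l) x)
  shift : Covers (allPairs l x) i j → Covers (allPairs (suc l) (l ↑ʳ x)) (suc i) (suc j)
  shift (inj₁ eq) = inj₁ (trans shifted (cong (Product.map suc suc) eq))
  shift (inj₂ eq) = inj₂ (trans shifted (cong (Product.map suc suc) eq))

allPairsSchedule : ∀ l → PairSchedule (triangle l) l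
allPairsSchedule l = record
  { pairAt = allPairs l ; distinct = allPairs-distinct l ; covers = allPairs-covers l }

extend : {X : Set} → (Fin a → X) → X → Fin b → X
extend {a} f d x with toℕ x <? a
... | yes x<a = f (fromℕ< x<a)
... | no  _   = d

extend-inject≤ : {X : Set} (f : Fin a → X) (d : X) (a≤b : a ≤ b) (y : Fin a) → extend f d (inject≤ y a≤b) ≡ f y
extend-inject≤ {a} f d a≤b y with toℕ (inject≤ y a≤b) <? a
... | yes y<a = cong f (trans (fromℕ<-cong _ _ (toℕ-inject≤ y a≤b) y<a (toℕ<n y)) (fromℕ<-toℕ y _))
... | no  y≮a = ⊥-elim (y≮a (subst (_< a) (sym (toℕ-inject≤ y a≤b)) (toℕ<n y)))

extend-preserves : {X : Set} (P : X → Set) (f : Fin a → X) (d : X) → (∀ y → P (f y)) → P d → ∀ (x : Fin b) → P (extend f d x)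
extend-preserves {a} P f d Pf Pd x with toℕ x <? a
... | yes _ = Pf _
... | no  _ = Pd

padSchedule : ∀ {l} → PairSchedule a l → (d : Fin l × Fin l) → proj₁ d ≢ proj₂ d → a ≤ b → PairSchedule b l
padSchedule {a} {b} schedule d d-distinct a≤b = record
  { pairAt   = extend pairAt d
  ; distinct = extend-preserves (λ d → proj₁ d ≢ proj₂ d) pairAt d distinct d-distinct
  ; covers   = padded-covers
  }
  where
  open PairSchedule schedule
  padded-covers : ∀ i j → i ≢ j → ∃ λ x → Covers (extend pairAt d x) i j
  padded-covers i j i≢j with covers i j i≢j
  ... | y , cover = inject≤ y a≤b , subst (λ d → Covers d i j) (sym (extend-inject≤ pairAt d a≤b y)) cover

pairSchedule : ∀ a {M} → triangle (suc (suc a)) ≤ M → PairSchedule M (suc (suc a))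
pairSchedule a = padSchedule (allPairsSchedule (suc (suc a))) (zero , suc zero) (λ ())

-- Its ground set is Fin (suc r) with r = k + (k + 1).
-- Exactly one end of each edge {u, ∁ u} contains the element 0, so the
-- edges are indexed by the k-subsets p of the last r elements: the edge
-- with ends {0} ∪ p (side true) and the complement of p (side false).
module KneserMatching (k : ℕ) where

  -- 2 * suc k reduces to suc r.
  r : ℕ
  r = k + suc (k + 0)

  M : ℕ
  M = pascal r k

  balanced : k + suc k ≡ r
  balanced = cong (λ z → k + suc z) (sym (+-identityʳ k))

  Vertex : Set
  Vertex = KneserVertex (suc k)

  rank : SizedSubset r k → Fin M
  rank = Inverse.to (sizedSubset↔ r k)

  unrank : Fin M → SizedSubset r k
  unrank = Inverse.from (sizedSubset↔ r k)

  ∁-grow : (p : Subset r) → ∣ p ∣ ≡ k → ∣ ∁ p ∣ ≡ suc k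
  ∁-grow p e = size-∁ p e balanced

  ∁-shrink : (p : Subset r) → ∣ p ∣ ≡ suc k → ∣ ∁ p ∣ ≡ k
  ∁-shrink p e = size-∁ p e (trans (sym (+-suc k k)) balanced)

  endpoint : Fin M × Bool → Vertex
  endpoint (y , true)  = inside  ∷ proj₁ (unrank y) , cong suc (proj₂ (unrank y))
  endpoint (y , false) = outside ∷ ∁ (proj₁ (unrank y)) , ∁-grow (proj₁ (unrank y)) (proj₂ (unrank y))

  locate : Vertex → Fin M × Bool
  locate (inside  ∷ p , e) = rank (p , suc-injective e) , true
  locate (outside ∷ p , e) = rank (∁ p , ∁-shrink p e) , false

  endpoint-locate : ∀ v → endpoint (locate v) ≡ v
  endpoint-locate (inside  ∷ p , e) =
    sized-≡ (cong (inside ∷_) (cong proj₁ (Inverse.strictlyInverseʳ (sizedSubset↔ r k) _)))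
  endpoint-locate (outside ∷ p , e) =
    sized-≡ (cong (outside ∷_) (trans (cong (∁ ∘ proj₁) (Inverse.strictlyInverseʳ (sizedSubset↔ r k) _)) (∁-involutive p)))

  locate-endpoint : ∀ x → locate (endpoint x) ≡ x
  locate-endpoint (y , true)  =
    cong (_, true) (trans (cong rank (sized-≡ refl)) (Inverse.strictlyInverseˡ (sizedSubset↔ r k) y))
  locate-endpoint (y , false) =
    cong (_, false) (trans (cong rank (sized-≡ (∁-involutive _))) (Inverse.strictlyInverseˡ (sizedSubset↔ r k) y))

  endpoints-adjacent : ∀ x → Adj (Kneser (suc k)) (endpoint x) (endpoint (partner x))
  endpoints-adjacent (y , true)  = p∩∁p-empty (inside ∷ proj₁ (unrank y))
  endpoints-adjacent (y , false) = ∁p∩p-empty (inside ∷ proj₁ (unrank y))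

  complement : Vertex → Vertex
  complement (p , e) = ∁ p , size-∁ p e (cong suc balanced)

  adjacent⇒complement : ∀ {u v} → Adj (Kneser (suc k)) u v → v ≡ complement u
  adjacent⇒complement {p , e} {q , e′} disjoint =
    sized-≡ (disjoint-full⇒∁ p q disjoint (trans (cong₂ _+_ e e′) (cong suc balanced)))

  locate-complement : ∀ u → locate (complement u) ≡ partner (locate u)
  locate-complement (inside  ∷ p , e) = cong (_, false) (cong rank (sized-≡ (∁-involutive p)))
  locate-complement (outside ∷ p , e) = cong (_, true) (cong rank (sized-≡ refl))

  kneserMatching : PerfectMatching (Kneser (suc k)) M
  kneserMatching = record
    { endpoint           = endpoint
    ; locate             = locate
    ; endpoint-locate    = endpoint-locate
    ; locate-endpoint    = locate-endpoint
    ; endpoints-adjacent = endpoints-adjacent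
    ; adjacent⇒partner   = λ {u} adj → trans (cong locate (adjacent⇒complement adj)) (locate-complement u)
    }

  vertexCount : (2 * suc k) C suc k ≡ 2 * M
  vertexCount = begin
    suc r C suc k                ≡⟨ pascal≡C (suc r) (suc k) ⟨
    M + pascal r (suc k)         ≡⟨ cong (M +_) symmetric ⟩
    M + M                        ≡⟨ cong (M +_) (+-identityʳ M) ⟨
    M + (M + 0)                  ∎
    where
    open ≡-Reasoning
    symmetric : pascal r (suc k) ≡ M
    symmetric = begin
      pascal r (suc k)     ≡⟨ pascal≡C r (suc k) ⟩
      r C suc k            ≡⟨ nCk≡nC[n∸k] (subst (suc k ≤_) balanced (m≤n+m (suc k) k)) ⟩
      r C (r ∸ suc k)      ≡⟨ cong (r C_) (trans (cong (_∸ suc k) (sym balanced)) (m+n∸n≡m k (suc k))) ⟩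
      r C k                ≡⟨ pascal≡C r k ⟨
      M                    ∎

odd-square : ∀ a → suc (a * 2) * suc (a * 2) ≡ 1 + 4 * (suc a * a)
odd-square = solve-∀

square-reflects-< : ∀ {x y} → x * x < y * y → x < y
square-reflects-< {x} {y} x²<y² with x <? y
... | yes x<y = x<y
... | no  x≮y = ⊥-elim (<⇒≱ x²<y² (*-mono-≤ (≮⇒≥ x≮y) (≮⇒≥ x≮y)))

module FloorSqrt (N s : ℕ) (isFloorSqrt : IsFloorSqrt (1 + 4 * N) s) where

  L : ℕ
  L = (1 + s) / 2

  fits⇒≤L : ∀ {a} → suc a * a ≤ N → suc a ≤ L
  fits⇒≤L {a} fits = begin
    suc a              ≡⟨ m*n/n≡m (suc a) 2 ⟨
    suc a * 2 / 2      ≤⟨ /-monoˡ-≤ 2 odd<1+s ⟩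
    L                  ∎
    where
    open ≤-Reasoning
    odd<1+s : suc (a * 2) < suc s
    odd<1+s = square-reflects-< (begin-strict
      suc (a * 2) * suc (a * 2) ≡⟨ odd-square a ⟩
      1 + 4 * (suc a * a)       ≤⟨ +-monoʳ-≤ 1 (*-monoʳ-≤ 4 fits) ⟩
      1 + 4 * N                 <⟨ proj₂ isFloorSqrt ⟩
      suc s * suc s             ∎)

  L-fits : ∀ {a} → L ≡ suc a → suc a * a ≤ N
  L-fits {a} L≡1+a = *-cancelˡ-≤ 4 (s≤s⁻¹ (begin
    1 + 4 * (suc a * a)       ≡⟨ odd-square a ⟨
    suc (a * 2) * suc (a * 2) ≤⟨ *-mono-≤ odd≤s odd≤s ⟩
    s * s                     ≤⟨ proj₁ isFloorSqrt ⟩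
    1 + 4 * N                 ∎))
    where
    open ≤-Reasoning
    odd≤s : suc (a * 2) ≤ s
    odd≤s = s≤s⁻¹ (subst (λ x → x * 2 ≤ 1 + s) L≡1+a (m/n*n≤m (1 + s) 2))

sandwich : (G : Graph) {L : ℕ} → HasProperComplete G L → (∀ m → HasComplete G m → m ≤ L) →
  AchromaticNumber G L × PseudoachromaticNumber G L
sandwich G (c , surjective , proper , complete) bound =
  ((c , surjective , proper , complete) , λ m (c′ , surj′ , _ , compl′) → bound m (c′ , surj′ , compl′)) ,
  ((c , surjective , complete) , bound)

mainTheorem8 : (k : ℕ) → 1 ≤ k → (s : ℕ) → IsFloorSqrt (1 + 4 * ((2 * k) C k)) s →
    AchromaticNumber (Kneser k) ((1 + s) / 2) × PseudoachromaticNumber (Kneser k) ((1 + s) / 2)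
mainTheorem8 (suc k) _ s isFloorSqrt = sandwich (Kneser (suc k)) properComplete colourBound
  where
  open KneserMatching k
  open FloorSqrt ((2 * suc k) C suc k) s isFloorSqrt

  colourBound : ∀ m → HasComplete (Kneser (suc k)) m → m ≤ L
  colourBound zero    _                    = z≤n
  colourBound (suc l) (c , _ , complete) =
    fits⇒≤L (subst (suc l * l ≤_) (sym vertexCount) (matching⇒colourBound kneserMatching c complete))

  -- There is at least one edge, so L ≥ 2.
  two≤L : 2 ≤ L
  two≤L = fits⇒≤L {1} (subst (2 ≤_) (sym vertexCount) (*-monoʳ-≤ 2 (pascal-positive (m≤m+n k _))))

  scheduled : ∀ {l} → 2 ≤ l → L ≡ l → HasProperComplete (Kneser (suc k)) l
  scheduled {suc (suc a)} (s≤s (s≤s z≤n)) L≡l = matching⇒properComplete kneserMatching (pairSchedule a (*-cancelˡ-≤ 2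
    (subst₂ _≤_ (sym (triangle-double (suc a))) vertexCount (L-fits L≡l))))

  properComplete : HasProperComplete (Kneser (suc k)) L
  properComplete = scheduled two≤L refl
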